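{- Let $f:\{0,1\}^n\to\{0,1\}$ and $\varepsilon>0$ be such that the distance from $f$ to the set of union-closed functions is at least $\varepsilon$. Then $f$ has at least $\varepsilon\cdot 2^n$ pairwise end-distinct UC-violating tuples.
   Context: Identify $x\in\{0,1\}^n$ with $\{i:x_i=1\}$; $\cup$ is coordinatewise OR. $f$ is union-closed if $f(x)=f(y)=1$ implies $f(x\cup y)=1$. Distance between $f,g$ is $\Pr_{\mathbf x}[f(\mathbf x)\ne g(\mathbf x)]$ for uniform $\mathbf x\in\{0,1\}^n$. A UC-violating tuple for $f$ is a sequence $(x_1,\dots,x_k,x_1\cup\dots\cup x_k)$ with $x_i\in\{0,1\}^n$, $f(x_j)=1$ for all $1\le j\le k$, and $f(x_1\cup\dots\cup x_k)=0$. Two UC-violating tuples $(x_1,\dots,x_k,x_1\cup\dots\cup x_k)$ and $(y_1,\dots,y_{k'},y_1\cup\dots\cup y_{k'})$ are end-distinct if $x_1\cup\dots\cup x_k\ne y_1\cup\dots\cup y_{k'}$.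
   Formalization: The parameter ε ranges over the positive rationals. -}

module Defs where

open import Data.Bool using (Bool; true; false; _∨_)
open import Data.Bool.Properties using () renaming (_≟_ to _≟ᵇ_)
open import Data.Nat using (ℕ; zero; suc; _^_)
open import Data.Nat.Properties using (m^n≢0)
open import Data.Integer using (+_)
open import Data.Rational using (ℚ; _/_)
open import Data.Vec using (Vec; []; _∷_; zipWith)
open import Data.List using (List; []; _∷_; map; _++_; filter; length)
open import Data.List.NonEmpty using (List⁺; foldr₁)
open import Data.List.Relation.Unary.All using (All)
open import Data.Product using (_×_)
open import Relation.Nullary using (¬_; ¬?)
open import Relation.Binary.PropositionalEquality using (_≡_; _≢_)

-- Points of the cube {0,1}^n; x_i = true means i ∈ x.
Point : ℕ → Set
Point n = Vec Bool n

BoolFn : ℕ → Set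
BoolFn n = Point n → Bool

_∪_ : ∀ {n} → Point n → Point n → Point n
_∪_ = zipWith _∨_

UnionClosed : ∀ {n} → BoolFn n → Set
UnionClosed {n} f = ∀ (x y : Point n) → f x ≡ true → f y ≡ true → f (x ∪ y) ≡ true

allPoints : ∀ n → List (Point n)
allPoints zero = [] ∷ []
allPoints (suc n) = map (false ∷_) (allPoints n) ++ map (true ∷_) (allPoints n)

disagreements : ∀ {n} → BoolFn n → BoolFn n → ℕ
disagreements {n} f g = length (filter (λ x → ¬? (f x ≟ᵇ g x)) (allPoints n))

dist : ∀ {n} → BoolFn n → BoolFn n → ℚ
dist {n} f g = (+ disagreements f g) / (2 ^ n)
  where instance _ = m^n≢0 2 n

-- A tuple (x_1,…,x_k, x_1 ∪ … ∪ x_k) with k ≥ 1 is determined by the nonempty list x_1,…,x_k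
Tuple : ℕ → Set
Tuple n = List⁺ (Point n)

-- its last entry x_1 ∪ … ∪ x_k
end : ∀ {n} → Tuple n → Point n
end = foldr₁ _∪_

UCViolating : ∀ {n} → BoolFn n → Tuple n → Set
UCViolating f t = All (λ x → f x ≡ true) (Data.List.NonEmpty.toList t) × f (end t) ≡ false

EndDistinct : ∀ {n} → Tuple n → Tuple n → Set
EndDistinct t u = end t ≢ end u

{-# OPTIONS --safe #-}
module Submission where

-- Let g be the union-closure of f: g z = 1 iff z is the union of a nonempty family of points
-- where f = 1. Then g is union-closed and g ≥ f, so by hypothesis f and g differ on at least
-- ε 2^n points. At each such point z we have f z = 0 while z = x₁ ∪ … ∪ xₖ with f xᵢ = 1,
-- i.e. a UC-violating tuple ending at z; tuples at different points z are end-distinct.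

open import Defs
open import Data.Nat using (ℕ; _^_)
open import Data.Integer using (+_)
open import Data.Rational using (ℚ; 0ℚ; _<_; _≤_; _*_; _/_)
open import Data.List using (List; length)
open import Data.List.Relation.Unary.All using (All)
open import Data.List.Relation.Unary.AllPairs using (AllPairs)
open import Data.Product using (Σ; _×_)

open import Data.Bool using (true; false)
open import Data.Bool.Properties using () renaming (_≟_ to _≟ᵇ_)
open import Data.Empty using (⊥-elim)
open import Data.Fin.Subset using (_⊆_)
open import Data.Fin.Subset.Properties using (_⊆?_; p⊆p∪q; q⊆p∪q; x∈p∪q⁻; ∪-assoc; ⊆-refl; ⊆-trans; ⊆-antisym)
import Data.Integer as ℤ
import Data.Integer.Properties as ℤ
open import Data.List using ([]; _∷_; map; filter)
open import Data.List.Membership.Propositional using (_∈_)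
open import Data.List.Membership.Propositional.Properties using (∈-filter⁺; ∈-filter⁻; ∈-map⁺; ∈-map⁻; ∈-++⁺ˡ; ∈-++⁺ʳ)
open import Data.List.NonEmpty using (_∷_; toList; _⁺++⁺_)
open import Data.List.Properties using (length-map)
import Data.List.Relation.Unary.All as All
import Data.List.Relation.Unary.All.Properties as All
import Data.List.Relation.Unary.AllPairs.Properties as AllPairs
open import Data.List.Relation.Unary.Any using (here; there)
open import Data.List.Relation.Unary.Any.Properties using (¬Any[])
open import Data.List.Relation.Unary.Unique.Propositional using (Unique)
import Data.List.Relation.Unary.Unique.Propositional.Properties as Unique
import Data.Nat as ℕ
import Data.Nat.Properties as ℕ
open import Data.Product using (_,_; proj₁; proj₂; ∃)
open import Data.Rational using (toℚᵘ)
open import Data.Rational.Properties using (toℚᵘ-injective; toℚᵘ-homo-*; toℚᵘ-fromℚᵘ; *-monoʳ-≤-nonNeg; normalize-nonNeg; ≤-trans; ≤-reflexive)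
import Data.Rational.Unnormalised as ℚᵘ
import Data.Rational.Unnormalised.Properties as ℚᵘ
open import Data.Sum using ([_,_])
open import Data.Vec using ([]; _∷_)
open import Data.Vec.Properties using (≡-dec; ∷-injectiveʳ)
open import Function using (_∘_)
open import Relation.Binary.PropositionalEquality using (_≡_; _≢_; refl; sym; trans; cong; subst; module ≡-Reasoning)
open import Relation.Nullary using (¬_; ¬?; Dec; yes; no; does)
open import Relation.Nullary.Decidable using (_×-dec_; dec-true)

i/n*n≡i : ∀ (i : ℤ.ℤ) n .{{_ : ℕ.NonZero n}} → (i / n) * (+ n / 1) ≡ i / 1
i/n*n≡i i n@(ℕ.suc _) = toℚᵘ-injective (begin-equality
  toℚᵘ ((i / n) * (+ n / 1))        ≃⟨ toℚᵘ-homo-* (i / n) (+ n / 1) ⟩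
  toℚᵘ (i / n) ℚᵘ.* toℚᵘ (+ n / 1)  ≃⟨ ℚᵘ.*-cong (toℚᵘ-fromℚᵘ (i ℚᵘ./ n)) (toℚᵘ-fromℚᵘ (+ n ℚᵘ./ 1)) ⟩
  (i ℚᵘ./ n) ℚᵘ.* (+ n ℚᵘ./ 1)      ≃⟨ cancel ⟩
  i ℚᵘ./ 1                          ≃⟨ toℚᵘ-fromℚᵘ (i ℚᵘ./ 1) ⟨
  toℚᵘ (i / 1)                      ∎)
  where
  open ℚᵘ.≤-Reasoning
  cancel : (i ℚᵘ./ n) ℚᵘ.* (+ n ℚᵘ./ 1) ℚᵘ.≃ i ℚᵘ./ 1
  cancel = ℚᵘ.*≡* (trans (ℤ.*-identityʳ (i ℤ.* + n)) (cong (λ k → i ℤ.* + k) (sym (ℕ.*-identityʳ n))))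

p≤i/n⇒p*n≤i : ∀ (p : ℚ) i n .{{_ : ℕ.NonZero n}} → p ≤ i / n → p * (+ n / 1) ≤ i / 1
p≤i/n⇒p*n≤i p i n@(ℕ.suc _) p≤i/n =
  ≤-trans (*-monoʳ-≤-nonNeg (+ n / 1) {{normalize-nonNeg n 1}} p≤i/n) (≤-reflexive (i/n*n≡i i n))

preimages : ∀ {a b p} {A : Set a} {B : Set b} {P : A → Set p} (h : A → B) {bs : List B} →
            All (λ y → ∃ λ x → P x × h x ≡ y) bs → ∃ λ xs → All P xs × map h xs ≡ bs
preimages h All.[] = [] , All.[] , refl
preimages h ((x , px , refl) All.∷ rest) with preimages h rest
... | xs , pxs , refl = x ∷ xs , px All.∷ pxs , refl

module _ {n : ℕ} where

  ∪-least : {p q r : Point n} → p ⊆ r → q ⊆ r → p ∪ q ⊆ r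
  ∪-least {p} {q} p⊆r q⊆r = [ p⊆r , q⊆r ] ∘ x∈p∪q⁻ p q

  ⊆-end : ∀ {y} x (xs : List (Point n)) → y ∈ x ∷ xs → y ⊆ end (x ∷ xs)
  ⊆-end x []       (here refl) = ⊆-refl
  ⊆-end x (y ∷ ys) (here refl) = p⊆p∪q (end (y ∷ ys))
  ⊆-end x (y ∷ ys) (there y∈)  = ⊆-trans (⊆-end y ys y∈) (q⊆p∪q x _)

  end-least : ∀ {z} x (xs : List (Point n)) → (∀ {y} → y ∈ x ∷ xs → y ⊆ z) → end (x ∷ xs) ⊆ z
  end-least x []       bound = bound (here refl)
  end-least x (y ∷ ys) bound = ∪-least (bound (here refl)) (end-least y ys (bound ∘ there))

  end-⁺++⁺ : ∀ x (xs : List (Point n)) (u : Tuple n) → end ((x ∷ xs) ⁺++⁺ u) ≡ end (x ∷ xs) ∪ end u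
  end-⁺++⁺ x []       (v ∷ vs) = refl
  end-⁺++⁺ x (y ∷ ys) u@(v ∷ vs) = begin
    x ∪ end ((y ∷ ys) ⁺++⁺ u)   ≡⟨ cong (x ∪_) (end-⁺++⁺ y ys u) ⟩
    x ∪ (end (y ∷ ys) ∪ end u)  ≡⟨ sym (∪-assoc x _ _) ⟩
    (x ∪ end (y ∷ ys)) ∪ end u  ∎
    where open ≡-Reasoning

∈-allPoints : ∀ {n} (x : Point n) → x ∈ allPoints n
∈-allPoints []          = here refl
∈-allPoints (false ∷ x) = ∈-++⁺ˡ (∈-map⁺ (false ∷_) (∈-allPoints x))
∈-allPoints (true ∷ x)  = ∈-++⁺ʳ _ (∈-map⁺ (true ∷_) (∈-allPoints x))

allPoints-unique : ∀ n → Unique (allPoints n)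
allPoints-unique ℕ.zero    = All.[] AllPairs.∷ AllPairs.[]
allPoints-unique (ℕ.suc n) =
  Unique.++⁺ (Unique.map⁺ ∷-injectiveʳ (allPoints-unique n))
             (Unique.map⁺ ∷-injectiveʳ (allPoints-unique n))
             disjoint
  where
  disjoint : ∀ {x} → ¬ (x ∈ map (false ∷_) (allPoints n) × x ∈ map (true ∷_) (allPoints n))
  disjoint (x∈₀ , x∈₁) with ∈-map⁻ (false ∷_) x∈₀ | ∈-map⁻ (true ∷_) x∈₁
  ... | _ , _ , refl | _ , _ , ()

module _ {n : ℕ} (f : BoolFn n) where

  Generated : Point n → Set
  Generated z = Σ (Tuple n) λ t → All (λ x → f x ≡ true) (toList t) × end t ≡ z

  -- z is generated iff the (nonempty) list of all true points below z has union z.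
  generatedFrom? : ∀ z (L : List (Point n)) →
                   (∀ {x} → x ∈ L → f x ≡ true × x ⊆ z) →
                   (∀ {x} → f x ≡ true → x ⊆ z → x ∈ L) →
                   Dec (Generated z)
  generatedFrom? z [] sound complete =
    no λ { (x ∷ xs , fx All.∷ _ , refl) → ¬Any[] (complete fx (⊆-end x xs (here refl))) }
  generatedFrom? z (a ∷ as) sound complete with ≡-dec _≟ᵇ_ (end (a ∷ as)) z
  ... | yes a∷as↦z = yes (a ∷ as , All.tabulate (proj₁ ∘ sound) , a∷as↦z)
  ... | no a∷as↛z = no λ { (x ∷ xs , trues , refl) → a∷as↛z (⊆-antisym
          (end-least a as (proj₂ ∘ sound))
          (end-least x xs λ y∈ → ⊆-end a as (complete (All.lookup trues y∈) (⊆-end x xs y∈)))) }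

  generated? : ∀ z → Dec (Generated z)
  generated? z = generatedFrom? z (filter trueBelow? (allPoints n))
    (proj₂ ∘ ∈-filter⁻ trueBelow? {xs = allPoints n})
    (λ {x} fx x⊆z → ∈-filter⁺ trueBelow? (∈-allPoints x) (fx , x⊆z))
    where
    trueBelow? : ∀ x → Dec (f x ≡ true × x ⊆ z)
    trueBelow? x = (f x ≟ᵇ true) ×-dec (x ⊆? z)

  unionClosure : BoolFn n
  unionClosure z = does (generated? z)

  unionClosure⇒generated : ∀ {z} → unionClosure z ≡ true → Generated z
  unionClosure⇒generated {z} with generated? z
  ... | yes z-gen = λ _ → z-gen
  ... | no _      = λ ()

  generated⇒unionClosure : ∀ {z} → Generated z → unionClosure z ≡ true
  generated⇒unionClosure {z} = dec-true (generated? z)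

  true⇒unionClosure : ∀ {z} → f z ≡ true → unionClosure z ≡ true
  true⇒unionClosure {z} fz = generated⇒unionClosure (z ∷ [] , fz All.∷ All.[] , refl)

  unionClosure-unionClosed : UnionClosed unionClosure
  unionClosure-unionClosed x y cx cy
    with unionClosure⇒generated cx | unionClosure⇒generated cy
  ... | a ∷ as , trues , refl | u@(_ ∷ _) , trues′ , refl =
    generated⇒unionClosure (((a ∷ as) ⁺++⁺ u) , All.++⁺ trues trues′ , end-⁺++⁺ a as u)

  disagreement⇒violation : ∀ {z} → f z ≢ unionClosure z → ∃ λ t → UCViolating f t × end t ≡ z
  disagreement⇒violation {z} fz≢cz with f z in fz | unionClosure z in cz
  ... | true  | true  = ⊥-elim (fz≢cz refl)
  ... | false | false = ⊥-elim (fz≢cz refl)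
  ... | true  | false with () ← trans (sym cz) (true⇒unionClosure fz)
  ... | false | true  with unionClosure⇒generated cz
  ...   | t , trues , t↦z = t , (trues , subst (λ w → f w ≡ false) (sym t↦z) fz) , t↦z

  disagree? : ∀ x → Dec (f x ≢ unionClosure x)
  disagree? x = ¬? (f x ≟ᵇ unionClosure x)

  endDistinctViolations : Σ (List (Tuple n)) λ ts →
    All (UCViolating f) ts × AllPairs EndDistinct ts × length ts ≡ disagreements f unionClosure
  endDistinctViolations
    with preimages end (All.tabulate (disagreement⇒violation ∘ proj₂ ∘ ∈-filter⁻ disagree? {xs = allPoints n}))
  ... | ts , violating , ends =
    ts , violating ,
    AllPairs.map⁻ (subst (AllPairs _≢_) (sym ends) (Unique.filter⁺ _ (allPoints-unique n))) ,
    trans (sym (length-map end ts)) (cong length ends)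

lemma5p2 : (n : ℕ) (f : BoolFn n) (ε : ℚ) → 0ℚ < ε →
    (∀ (g : BoolFn n) → UnionClosed g → ε ≤ dist f g) →
    Σ (List (Tuple n)) (λ ts →
    All (UCViolating f) ts × AllPairs EndDistinct ts × ε * ((+ (2 ^ n)) / 1) ≤ (+ length ts) / 1)
lemma5p2 n f ε _ far with endDistinctViolations f
... | ts , violating , distinct , length≡ =
  ts , violating , distinct , subst (λ k → ε * (+ (2 ^ n) / 1) ≤ + k / 1) (sym length≡) bound
  where
  bound : ε * (+ (2 ^ n) / 1) ≤ + disagreements f (unionClosure f) / 1
  bound = p≤i/n⇒p*n≤i ε (+ disagreements f (unionClosure f)) (2 ^ n) {{ℕ.m^n≢0 2 n}}
            (far (unionClosure f) (unionClosure-unionClosed f))
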